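{- For each positive integer $n$, define a map $U$ on $C(n)$ as follows. Given $c \in C(n)$, append a final part $0$ if $c$ has odd length, so that $c=(c_1,\ldots,c_{2u})$. Replace each pair $(c_{2i-1},c_{2i})$, $1\le i\le u$, by \[ \begin{cases} (1^{c_{2i-1}-c_{2i}-1},\,2c_{2i}+1) & \text{if } c_{2i}-c_{2i-1}<0,\\ (1^{c_{2i-1}+c_{2i}-2k},\,2k) & \text{if } 2k-2 \le c_{2i}-c_{2i-1} < 2k \text{ for an integer } k\ge 1,\end{cases}\] and let $U(c)$ be the concatenation of these blocks in order. Then $U$ is a permutation (bijection) of $C(n)$.
   Context: $C(n)$ is the set of compositions of $n$, i.e., finite sequences of positive integers summing to $n$. The notation $1^m$ denotes $m$ consecutive parts equal to $1$ (nothing if $m=0$). In the first case with $c_{2i}=0$ (only possible for an appended final $0$), the block $(1^{c_{2i-1}-1},1)$ is simply $c_{2i-1}$ parts equal to $1$. -}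

module Defs where

open import Data.Nat using (ℕ; zero; suc; _+_; _*_; _∸_; _<_; _<ᵇ_; ⌊_/2⌋)
open import Data.Bool using (if_then_else_)
open import Data.List using (List; []; _∷_; _++_; replicate)
open import Data.Nat.ListAction using (sum)
open import Data.List.Relation.Unary.All using (All)
open import Data.Product using (_×_)
open import Relation.Binary.PropositionalEquality using (_≡_)

IsComp : ℕ → List ℕ → Set
IsComp n c = All (λ x → 0 < x) c × sum c ≡ n

-- Case 2k-2 ≤ b - a < 2k, k ≥ 1: here k = ⌊(b-a)/2⌋ + 1 is the unique such k;
--   block (1^{a+b-2k}, 2k).
block : ℕ → ℕ → List ℕ
block a b =
  if b <ᵇ a
  then replicate (a ∸ b ∸ 1) 1 ++ (2 * b + 1 ∷ [])
  else replicate (a + b ∸ 2 * k) 1 ++ (2 * k ∷ [])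
  where
  k : ℕ
  k = suc ⌊ (b ∸ a) /2⌋

U : List ℕ → List ℕ
U [] = []
U (a ∷ []) = block a 0
U (a ∷ b ∷ rest) = block a b ++ U rest

{-# OPTIONS --safe #-}
-- A pair (a, b) with a ≥ 1 becomes a block 1^j m with j + m = a + b, and the pair can be
-- read back from (j, m): the last part m is odd, m = 2b + 1, exactly when b < a, and then
-- a = b + j + 1; for even m one has a = ⌊j/2⌋ + 1 and b = ⌈j/2⌉ + m − 1. As m ≥ 2 whenever
-- b ≥ 1, U(c) is decoded by cutting it after each part ≥ 2, a trailing run 1^a coming from a
-- final part a (the pair (a, 0)). So U has a two-sided inverse and preserves sums.
module Submission where

open import Defs
open import Data.Nat
  using (ℕ; zero; suc; _+_; _*_; _∸_; _<_; _≤_; z≤n; s≤s; z<s; _<ᵇ_; pred; ⌊_/2⌋; ⌈_/2⌉; parity)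
open import Data.Nat.Properties
open import Data.Nat.ListAction using (sum)
open import Data.Nat.ListAction.Properties using (sum-++)
open import Data.Nat.Tactic.RingSolver using (solve-∀)
open import Data.Parity.Base using (0ℙ; 1ℙ)
open import Data.Bool using (true; false; T)
open import Data.Unit using (tt)
open import Data.Empty using (⊥-elim)
open import Data.List using (List; []; _∷_; _++_; _∷ʳ_; replicate)
open import Data.List.Properties using (++-assoc)
open import Data.List.Relation.Unary.All using (All; []; _∷_)
open import Data.List.Relation.Unary.All.Properties using (++⁺)
open import Data.Product using (_×_; _,_; proj₁; proj₂; ∃; ∃₂)
open import Function using (flip)
open import Relation.Nullary using (yes; no)
open import Relation.Binary.PropositionalEquality
  using (_≡_; refl; sym; trans; cong; cong₂; subst; subst₂; module ≡-Reasoning)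
open ≡-Reasoning

data Halved : ℕ → Set where
  halved : ∀ r s → r ≤ 1 → Halved (r + (s + s))

halve : ∀ n → Halved n
halve zero = halved 0 0 z≤n
halve (suc zero) = halved 1 0 ≤-refl
halve (suc (suc n)) with halve n
... | halved r s r≤1 = subst Halved (r+[1+s+1+s]≡2+r+[s+s] r s) (halved r (suc s) r≤1)
  where
  r+[1+s+1+s]≡2+r+[s+s] : ∀ r s → r + (suc s + suc s) ≡ suc (suc (r + (s + s)))
  r+[1+s+1+s]≡2+r+[s+s] = solve-∀

⌊r+[s+s]/2⌋≡s : ∀ {r} s → r ≤ 1 → ⌊ r + (s + s) /2⌋ ≡ s
⌊r+[s+s]/2⌋≡s s z≤n = sym (n≡⌊n+n/2⌋ s)
⌊r+[s+s]/2⌋≡s s (s≤s z≤n) = sym (n≡⌈n+n/2⌉ s)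

⌈r+[s+s]/2⌉≡r+s : ∀ {r} s → r ≤ 1 → ⌈ r + (s + s) /2⌉ ≡ r + s
⌈r+[s+s]/2⌉≡r+s s z≤n = sym (n≡⌈n+n/2⌉ s)
⌈r+[s+s]/2⌉≡r+s s (s≤s z≤n) = cong suc (sym (n≡⌊n+n/2⌋ s))

parity[n+n]≡0ℙ : ∀ n → parity (n + n) ≡ 0ℙ
parity[n+n]≡0ℙ zero = refl
parity[n+n]≡0ℙ (suc n) rewrite +-suc n n = parity[n+n]≡0ℙ n

parity[1+n+n]≡1ℙ : ∀ n → parity (suc (n + n)) ≡ 1ℙ
parity[1+n+n]≡1ℙ zero = refl
parity[1+n+n]≡1ℙ (suc n) rewrite +-suc n n = parity[1+n+n]≡1ℙ n

block-< : ∀ {a b} → b < a → block a b ≡ replicate (a ∸ b ∸ 1) 1 ∷ʳ (2 * b + 1)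
block-< {a} {b} b<a with b <ᵇ a | <⇒<ᵇ b<a
... | true  | _ = refl
... | false | ()

block-≥ : ∀ {a b} → a ≤ b →
  block a b ≡ replicate (a + b ∸ 2 * suc ⌊ (b ∸ a) /2⌋) 1 ∷ʳ 2 * suc ⌊ (b ∸ a) /2⌋
block-≥ {a} {b} a≤b with b <ᵇ a in b<ᵇa
... | false = refl
... | true  = ⊥-elim (<⇒≱ (<ᵇ⇒< b a (subst T (sym b<ᵇa) tt)) a≤b)

block-odd : ∀ b e → block (suc (b + e)) b ≡ replicate e 1 ∷ʳ suc (b + b)
block-odd b e =
  trans (block-< (s≤s (m≤m+n b e))) (cong₂ (λ j m → replicate j 1 ∷ʳ m) ones (2n+1≡1+n+n b))
  where
  2n+1≡1+n+n : ∀ n → 2 * n + 1 ≡ suc (n + n)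
  2n+1≡1+n+n = solve-∀
  ones : suc (b + e) ∸ b ∸ 1 ≡ e
  ones = cong (_∸ 1) (trans (cong (_∸ b) (sym (+-suc b e))) (m+n∸m≡n b (suc e)))

block-even : ∀ r s q → r ≤ 1 →
  block (suc s) (suc s + (r + (q + q))) ≡ replicate (r + (s + s)) 1 ∷ʳ suc (suc (q + q))
block-even r s q r≤1
  rewrite block-≥ (m≤m+n (suc s) (r + (q + q)))
        | m+n∸m≡n (suc s) (r + (q + q))
        | ⌊r+[s+s]/2⌋≡s q r≤1
  = cong₂ (λ j m → replicate j 1 ∷ʳ m) ones (2[1+n]≡2+n+n q)
  where
  2[1+n]≡2+n+n : ∀ n → 2 * suc n ≡ suc (suc (n + n))
  2[1+n]≡2+n+n = solve-∀
  ones : suc s + (suc s + (r + (q + q))) ∸ 2 * suc q ≡ r + (s + s)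
  ones = trans (cong (_∸ 2 * suc q) (rearrange r s q)) (m+n∸n≡m (r + (s + s)) (2 * suc q))
    where
    rearrange : ∀ r s q → suc s + (suc s + (r + (q + q))) ≡ r + (s + s) + 2 * suc q
    rearrange = solve-∀

data BlockCase : ℕ → ℕ → Set where
  odd-block  : ∀ b e → BlockCase (suc (b + e)) b
  even-block : ∀ r s q → r ≤ 1 → BlockCase (suc s) (suc s + (r + (q + q)))

blockCase : ∀ a b → BlockCase (suc a) b
blockCase a b with b ≤? a
... | yes b≤a with m≤n⇒∃[o]m+o≡n b≤a
...   | e , refl = odd-block b e
blockCase a b | no b≰a with m≤n⇒∃[o]m+o≡n (≰⇒> b≰a)
...   | d , refl with halve d
...     | halved r q r≤1 = even-block r a q r≤1

ones-∷ʳ-IsComp : ∀ j {m} → 0 < m → IsComp (j + m) (replicate j 1 ∷ʳ m)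
ones-∷ʳ-IsComp zero m>0 = m>0 ∷ [] , +-identityʳ _
ones-∷ʳ-IsComp (suc j) m>0 with ones-∷ʳ-IsComp j m>0
... | positive , sum≡ = z<s ∷ positive , cong suc sum≡

IsComp-++ : ∀ {m n xs ys} → IsComp m xs → IsComp n ys → IsComp (m + n) (xs ++ ys)
IsComp-++ {xs = xs} {ys} (positive₁ , sum₁) (positive₂ , sum₂) =
  ++⁺ positive₁ positive₂ , trans (sum-++ xs ys) (cong₂ _+_ sum₁ sum₂)

block-IsComp : ∀ {a} b → 0 < a → IsComp (a + b) (block a b)
block-IsComp {suc a} b _ with blockCase a b
... | odd-block b e =
  subst₂ IsComp (size b e) (sym (block-odd b e)) (ones-∷ʳ-IsComp e z<s)
  where
  size : ∀ b e → e + suc (b + b) ≡ suc (b + e) + b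
  size = solve-∀
... | even-block r s q r≤1 =
  subst₂ IsComp (size r s q) (sym (block-even r s q r≤1)) (ones-∷ʳ-IsComp (r + (s + s)) z<s)
  where
  size : ∀ r s q → r + (s + s) + suc (suc (q + q)) ≡ suc s + (suc s + (r + (q + q)))
  size = solve-∀

U-IsComp : ∀ {c} → All (0 <_) c → IsComp (sum c) (U c)
U-IsComp [] = [] , refl
U-IsComp {a ∷ []} (a>0 ∷ []) = block-IsComp 0 a>0
U-IsComp {a ∷ b ∷ c} (a>0 ∷ _ ∷ positive) =
  subst (flip IsComp _) (+-assoc a b (sum c))
        (IsComp-++ (block-IsComp b a>0) (U-IsComp positive))

unblock : ℕ → ℕ → ℕ × ℕ
unblock j m with parity m
... | 1ℙ = suc (⌊ m /2⌋ + j) , ⌊ m /2⌋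
... | 0ℙ = suc ⌊ j /2⌋ , ⌈ j /2⌉ + pred m

unblock-odd : ∀ j b → unblock j (suc (b + b)) ≡ (suc (b + j) , b)
unblock-odd j b rewrite parity[1+n+n]≡1ℙ b =
  cong (λ h → suc (h + j) , h) (sym (n≡⌈n+n/2⌉ b))

unblock-even : ∀ r s q → r ≤ 1 →
  unblock (r + (s + s)) (suc (suc (q + q))) ≡ (suc s , suc s + (r + (q + q)))
unblock-even r s q r≤1 rewrite parity[n+n]≡0ℙ q =
  cong₂ _,_ (cong suc (⌊r+[s+s]/2⌋≡s s r≤1))
            (trans (cong (_+ suc (q + q)) (⌈r+[s+s]/2⌉≡r+s s r≤1)) (rearrange r s q))
  where
  rearrange : ∀ r s q → r + s + suc (q + q) ≡ suc s + (r + (q + q))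
  rearrange = solve-∀

block-unblock : ∀ j m → 2 ≤ m →
  ∃₂ λ a b → unblock j m ≡ (suc a , suc b) × block (suc a) (suc b) ≡ replicate j 1 ∷ʳ m
block-unblock j (suc (suc m)) _ with halve m
... | halved 0 q _ with halve j
...   | halved r s r≤1 = s , s + (r + (q + q)) , unblock-even r s q r≤1 , block-even r s q r≤1
block-unblock j (suc (suc m)) _ | halved 1 q _ rewrite sym (+-suc q q) =
  suc q + j , q , unblock-odd j (suc q) , block-odd (suc q) j
block-unblock j (suc (suc m)) _ | halved (suc (suc _)) _ (s≤s ())
block-unblock j (suc zero) (s≤s ())

unblock-block : ∀ a b →
  ∃₂ λ j m → 2 ≤ m × block (suc a) (suc b) ≡ replicate j 1 ∷ʳ m × unblock j m ≡ (suc a , suc b)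
unblock-block a b with blockCase a (suc b)
... | odd-block _ e =
  e , suc (suc b + suc b) , s≤s (s≤s z≤n) , block-odd (suc b) e , unblock-odd e (suc b)
... | even-block r s q r≤1 =
  r + (s + s) , suc (suc (q + q)) , s≤s (s≤s z≤n) , block-even r s q r≤1 , unblock-even r s q r≤1

-- decode j xs inverts U on 1^j ++ xs: j counts the ones read since the last part ≥ 2.
decode : ℕ → List ℕ → List ℕ
decode j       (zero ∷ xs)        = decode j xs
decode j       (suc zero ∷ xs)    = decode (suc j) xs
decode j       (suc (suc m) ∷ xs) =
  proj₁ (unblock j (suc (suc m))) ∷ proj₂ (unblock j (suc (suc m))) ∷ decode 0 xs
decode zero    []                 = []
decode (suc j) []                 = suc j ∷ []

decode-replicate : ∀ i j ys → decode j (replicate i 1 ++ ys) ≡ decode (j + i) ys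
decode-replicate zero    j ys = cong (λ k → decode k ys) (sym (+-identityʳ j))
decode-replicate (suc i) j ys =
  trans (decode-replicate i (suc j) ys) (cong (λ k → decode k ys) (sym (+-suc j i)))

decode-U : ∀ {c} → All (0 <_) c → decode 0 (U c) ≡ c
decode-U [] = refl
decode-U {suc a ∷ []} _ = decode-replicate a 0 (1 ∷ [])
decode-U {suc a ∷ suc b ∷ c} (_ ∷ _ ∷ positive) with unblock-block a b
... | j , suc (suc m) , _ , block≡ , unblock≡ = begin
  decode 0 (block (suc a) (suc b) ++ U c)
    ≡⟨ cong (λ xs → decode 0 (xs ++ U c)) block≡ ⟩
  decode 0 ((replicate j 1 ∷ʳ suc (suc m)) ++ U c)
    ≡⟨ cong (decode 0) (++-assoc (replicate j 1) _ (U c)) ⟩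
  decode 0 (replicate j 1 ++ suc (suc m) ∷ U c)
    ≡⟨ decode-replicate j 0 _ ⟩
  decode j (suc (suc m) ∷ U c)
    ≡⟨ cong₂ (λ p c′ → proj₁ p ∷ proj₂ p ∷ c′) unblock≡ (decode-U positive) ⟩
  suc a ∷ suc b ∷ c ∎

replicate-++-∷ : ∀ {A : Set} n (x : A) ys → replicate n x ++ x ∷ ys ≡ x ∷ replicate n x ++ ys
replicate-++-∷ zero    x ys = refl
replicate-++-∷ (suc n) x ys = cong (x ∷_) (replicate-++-∷ n x ys)

U-decode : ∀ j {xs} → All (0 <_) xs → U (decode j xs) ≡ replicate j 1 ++ xs
U-decode zero    [] = refl
U-decode (suc j) [] = replicate-++-∷ j 1 []
U-decode j {suc zero ∷ xs} (_ ∷ positive) =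
  trans (U-decode (suc j) positive) (sym (replicate-++-∷ j 1 xs))
U-decode j {suc (suc m) ∷ xs} (_ ∷ positive)
  with block-unblock j (suc (suc m)) (s≤s (s≤s z≤n))
... | a , b , unblock≡ , block≡ = begin
  U (decode j (suc (suc m) ∷ xs))
    ≡⟨ cong (λ p → block (proj₁ p) (proj₂ p) ++ U (decode 0 xs)) unblock≡ ⟩
  block (suc a) (suc b) ++ U (decode 0 xs)
    ≡⟨ cong₂ _++_ block≡ (U-decode 0 positive) ⟩
  (replicate j 1 ∷ʳ suc (suc m)) ++ xs
    ≡⟨ ++-assoc (replicate j 1) _ xs ⟩
  replicate j 1 ++ suc (suc m) ∷ xs ∎

decode-positive : ∀ j {xs} → All (0 <_) xs → All (0 <_) (decode j xs)
decode-positive zero    [] = []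
decode-positive (suc j) [] = z<s ∷ []
decode-positive j {suc zero ∷ _} (_ ∷ positive) = decode-positive (suc j) positive
decode-positive j {suc (suc m) ∷ _} (_ ∷ positive)
  with block-unblock j (suc (suc m)) (s≤s (s≤s z≤n))
... | _ , _ , unblock≡ , _ rewrite unblock≡ = z<s ∷ z<s ∷ decode-positive 0 positive

theorem3p1 : (n : ℕ) → 0 < n →
    ((c : List ℕ) → IsComp n c → IsComp n (U c))
    × ((c d : List ℕ) → IsComp n c → IsComp n d → U c ≡ U d → c ≡ d)
    × ((d : List ℕ) → IsComp n d → ∃ λ c → IsComp n c × U c ≡ d)
theorem3p1 n _ = U-maps , U-injective , U-surjective
  where
  U-maps : (c : List ℕ) → IsComp n c → IsComp n (U c)
  U-maps c (positive , sum≡n) = subst (flip IsComp (U c)) sum≡n (U-IsComp positive)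

  U-injective : (c d : List ℕ) → IsComp n c → IsComp n d → U c ≡ U d → c ≡ d
  U-injective c d (positive-c , _) (positive-d , _) Uc≡Ud = begin
    c              ≡⟨ sym (decode-U positive-c) ⟩
    decode 0 (U c) ≡⟨ cong (decode 0) Uc≡Ud ⟩
    decode 0 (U d) ≡⟨ decode-U positive-d ⟩
    d              ∎

  U-surjective : (d : List ℕ) → IsComp n d → ∃ λ c → IsComp n c × U c ≡ d
  U-surjective d (positive , sum≡n) = c , (positive-c , sum≡) , U-decode 0 positive
    where
    c : List ℕ
    c = decode 0 d
    positive-c : All (0 <_) c
    positive-c = decode-positive 0 positive
    sum≡ : sum c ≡ n
    sum≡ = begin
      sum c     ≡⟨ sym (proj₂ (U-IsComp positive-c)) ⟩
      sum (U c) ≡⟨ cong sum (U-decode 0 positive) ⟩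
      sum d     ≡⟨ sum≡n ⟩
      n         ∎
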